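{- For all integers $n\ge 1$, $r\ge 2$, $s\ge 1$, $\chi_{la}\big(r((2s)P_2\vee O_{2n+1})\big)=3$.
   Context: For a graph $G$ with $q$ edges, a local antimagic labeling is a bijection $f:E(G)\to\{1,\dots,q\}$ such that, writing $f^+(u)=\sum_{e\ni u}f(e)$, we have $f^+(u)\ne f^+(v)$ for every edge $uv$. $\chi_{la}(G)$ is the minimum over all local antimagic labelings of the number of distinct values of $f^+$. $aP_2$ is the disjoint union of $a$ one-edge paths, $O_m$ the edgeless graph on $m$ vertices, $\vee$ the join, $rH$ the disjoint union of $r$ copies of $H$. -}

module Defs where

open import Data.Nat using (ℕ; zero; suc; _+_; _*_; _≤_)
open import Data.Nat.Properties using () renaming (_≟_ to _≟ℕ_)
open import Data.Fin as Fin using (Fin; toℕ; _↑ˡ_; _↑ʳ_; splitAt; remQuot)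
open import Data.Fin.Properties using () renaming (_≟_ to _≟F_)
open import Data.Product using (_×_; _,_; proj₁; proj₂; ∃; Σ)
import Data.Sum
open import Data.Sum using (inj₁; inj₂)
open import Data.Bool using (if_then_else_; _∨_)
open import Data.List using (List; length; tabulate; deduplicate)
open import Data.Nat.ListAction using (sum)
open import Relation.Nullary using (¬_)
open import Relation.Nullary.Decidable using (⌊_⌋)
open import Relation.Binary.PropositionalEquality using (_≡_)
open import Function.Bundles using (_⤖_; Bijection)

record Graph : Set where
  field
    V    : ℕ
    E    : ℕ
    ends : Fin E → Fin V × Fin V
open Graph public

O : ℕ → Graph
O m = record { V = m ; E = 0 ; ends = λ () }

P2 : Graph
P2 = record { V = 2 ; E = 1 ; ends = λ _ → (Fin.zero , Fin.suc Fin.zero) }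

_⊕_ : Graph → Graph → Graph
G ⊕ H = record
  { V = V G + V H
  ; E = E G + E H
  ; ends = λ e → go (splitAt (E G) e)
  }
  where
  go : Fin (E G) Data.Sum.⊎ Fin (E H) → Fin (V G + V H) × Fin (V G + V H)
  go (inj₁ e) = (proj₁ (ends G e) ↑ˡ V H , proj₂ (ends G e) ↑ˡ V H)
  go (inj₂ e) = (V G ↑ʳ proj₁ (ends H e) , V G ↑ʳ proj₂ (ends H e))

_∨G_ : Graph → Graph → Graph
G ∨G H = record
  { V = V G + V H
  ; E = (E G + E H) + V G * V H
  ; ends = λ e → go (splitAt (E G + E H) e)
  }
  where
  go : Fin (E G + E H) Data.Sum.⊎ Fin (V G * V H) → Fin (V G + V H) × Fin (V G + V H)
  go (inj₁ e) = ends (G ⊕ H) e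
  go (inj₂ p) = (proj₁ (remQuot {V G} (V H) p) ↑ˡ V H , V G ↑ʳ proj₂ (remQuot {V G} (V H) p))

copies : ℕ → Graph → Graph
copies zero    H = O 0
copies (suc r) H = H ⊕ copies r H

-- a labeling: a bijection E(G) → {1,…,q}, represented by a bijection Fin q ⤖ Fin q
-- (edge e gets label 1 + toℕ (to e))
Labeling : Graph → Set
Labeling G = Fin (E G) ⤖ Fin (E G)

label : (G : Graph) → Labeling G → Fin (E G) → ℕ
label G f e = suc (toℕ (Bijection.to f e))

vsum : (G : Graph) → Labeling G → Fin (V G) → ℕ
vsum G f u = sum (tabulate (λ e →
  if ⌊ u ≟F proj₁ (ends G e) ⌋ ∨ ⌊ u ≟F proj₂ (ends G e) ⌋
  then label G f e else 0))

IsLocalAntimagic : (G : Graph) → Labeling G → Set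
IsLocalAntimagic G f = (e : Fin (E G)) →
  ¬ (vsum G f (proj₁ (ends G e)) ≡ vsum G f (proj₂ (ends G e)))

numColors : (G : Graph) → Labeling G → ℕ
numColors G f = length (deduplicate _≟ℕ_ (tabulate (vsum G f)))

χla≡ : Graph → ℕ → Set
χla≡ G k =
  (Σ (Labeling G) λ f → IsLocalAntimagic G f × numColors G f ≡ k) ×
  ((f : Labeling G) → IsLocalAntimagic G f → k ≤ numColors G f)

-- Let m = 2n+1 and T = 2rs, the number of matching edges; an edge of weight w gets the label w+1.
-- The matching edges get the weights 0,…,T−1, where a weight ℓ and its reflection T−1−ℓ go to
-- two matching edges of the same copy. The cross edge from the first (second) end of a matching
-- edge to the i-th vertex of O gets a weight in the block [T(1+i), T(2+i)) (resp.
-- [T(2m−i), T(2m−i+1))), namely the block start plus one of the two reflections of the matching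
-- edge's weight, alternating with i. At an end of a matching edge the reflections pair up, so all
-- first ends have one vertex sum A and all second ends one sum B. At a vertex of O the four cross
-- edges coming from a reflected pair of matching edges use both reflections and two blocks that
-- add up to 2m+1, so all vertices of O have one sum C. As A, B and C are distinct, this is a local
-- antimagic labeling with three colours, and none has fewer since every copy contains a triangle.
module Submission where

open import Defs
open import Data.Bool.Base using (Bool; true; false; not; _xor_; _∨_; if_then_else_)
open import Data.Bool.Properties using (xor-identityʳ; xor-comm; true-xor; not-injective)
open import Data.Fin.Base
  using (Fin; zero; suc; toℕ; fromℕ<; _↑ˡ_; _↑ʳ_; splitAt; remQuot; combine; punchOut)
import Data.Fin.Properties as Finₚ
open Finₚ
  using (toℕ<n; toℕ-injective; toℕ-fromℕ<; ↑ˡ-injective; ↑ʳ-injective; splitAt-↑ˡ; splitAt-↑ʳ;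
         remQuot-combine; combine-remQuot; toℕ-↑ˡ; any?; punchOut-injective; injective⇒≤)
  renaming (_≟_ to _≟ᶠ_)
open import Data.List.Base using (List; []; _∷_; length; tabulate; deduplicate)
open import Data.List.Properties using (tabulate-cong; length-removeAt′)
open import Data.List.Membership.Propositional using (_∈_)
open import Data.List.Membership.Propositional.Properties using (∈-tabulate⁺; ∈-tabulate⁻; deduplicate-∈⇔)
open import Data.List.Relation.Binary.Subset.Propositional using (_⊆_)
open import Data.List.Relation.Unary.All as All using ([]; _∷_)
open import Data.List.Relation.Unary.AllPairs using ([]; _∷_)
open import Data.List.Relation.Unary.Any using (here; there; index; _─_)
open import Data.List.Relation.Unary.Unique.Propositional using (Unique)
open import Data.List.Relation.Unary.Unique.DecPropositional.Properties using (deduplicate-!)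
open import Data.Nat.Base
open import Data.Nat.Properties
open import Data.Nat.ListAction using (sum)
open import Data.Nat.Tactic.RingSolver using (solve-∀)
open import Data.Product.Base using (_×_; _,_; proj₁; proj₂; ∃-syntax; map; uncurry)
open import Data.Sum.Base using ([_,_]′)
open import Function.Base using (_∘_; id)
open import Function.Bundles using (Equivalence; _⤖_; mk⤖)
open import Function.Definitions using (Injective; Surjective)
open import Relation.Binary.PropositionalEquality
open import Relation.Nullary using (¬_; yes; no; contradiction)
open import Relation.Nullary.Decidable using (Dec; ⌊_⌋; isYes≗does; dec-true; dec-false)

data Split (k l : ℕ) : Fin (k + l) → Set where
  left  : ∀ i → Split k l (i ↑ˡ l)
  right : ∀ i → Split k l (k ↑ʳ i)

split : ∀ k l i → Split k l i
split zero    l i       = right i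
split (suc k) l zero    = left zero
split (suc k) l (suc i) with split k l i
... | left  j = left (suc j)
... | right j = right j

sum-tabulate-cong : ∀ {k} {f g : Fin k → ℕ} → (∀ i → f i ≡ g i) →
                    sum (tabulate f) ≡ sum (tabulate g)
sum-tabulate-cong f≗g = cong sum (tabulate-cong f≗g)

sum-tabulate-zero : ∀ {k} {f : Fin k → ℕ} → (∀ i → f i ≡ 0) → sum (tabulate f) ≡ 0
sum-tabulate-zero {zero}  f≡0 = refl
sum-tabulate-zero {suc k} f≡0 = cong₂ _+_ (f≡0 zero) (sum-tabulate-zero (f≡0 ∘ suc))

sum-tabulate-↑ : ∀ k l (f : Fin (k + l) → ℕ) →
                 sum (tabulate f) ≡ sum (tabulate (f ∘ (_↑ˡ l))) + sum (tabulate (f ∘ (k ↑ʳ_)))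
sum-tabulate-↑ zero    l f = refl
sum-tabulate-↑ (suc k) l f =
  trans (cong (f zero +_) (sum-tabulate-↑ k l (f ∘ suc))) (sym (+-assoc (f zero) _ _))

sum-tabulate-combine : ∀ k l (f : Fin (k * l) → ℕ) →
  sum (tabulate f) ≡ sum (tabulate λ i → sum (tabulate λ j → f (combine {k} {l} i j)))
sum-tabulate-combine zero    l f = refl
sum-tabulate-combine (suc k) l f = trans (sum-tabulate-↑ l (k * l) f)
  (cong (sum (tabulate (f ∘ (_↑ˡ k * l))) +_) (sum-tabulate-combine k l (f ∘ (l ↑ʳ_))))

sum-tabulate-single : ∀ {k} (f : Fin k → ℕ) i → (∀ j → j ≢ i → f j ≡ 0) → sum (tabulate f) ≡ f i
sum-tabulate-single f zero    f≡0 =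
  trans (cong (f zero +_) (sum-tabulate-zero λ j → f≡0 (suc j) λ ())) (+-identityʳ _)
sum-tabulate-single f (suc i) f≡0 = cong₂ _+_ (f≡0 zero λ ())
  (sum-tabulate-single (f ∘ suc) i λ j j≢i → f≡0 (suc j) (j≢i ∘ Finₚ.suc-injective))

sumTo : ℕ → (ℕ → ℕ) → ℕ
sumTo zero    f = 0
sumTo (suc k) f = sumTo k f + f k

syntax sumTo k (λ i → e) = ∑[ i < k ] e

∑-cons : ∀ k (f : ℕ → ℕ) → ∑[ i < suc k ] f i ≡ f 0 + ∑[ i < k ] f (suc i)
∑-cons zero    f = +-comm 0 (f 0)
∑-cons (suc k) f = trans (cong (_+ f (suc k)) (∑-cons k f)) (+-assoc (f 0) _ _)

sum-tabulate-toℕ : ∀ k (f : ℕ → ℕ) → sum (tabulate {n = k} (f ∘ toℕ)) ≡ ∑[ i < k ] f i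
sum-tabulate-toℕ zero    f = refl
sum-tabulate-toℕ (suc k) f = trans (cong (f 0 +_) (sum-tabulate-toℕ k (f ∘ suc))) (sym (∑-cons k f))

∑-cong< : ∀ k {f g : ℕ → ℕ} → (∀ i → i < k → f i ≡ g i) → ∑[ i < k ] f i ≡ ∑[ i < k ] g i
∑-cong< zero    f≗g = refl
∑-cong< (suc k) f≗g = cong₂ _+_ (∑-cong< k λ i i<k → f≗g i (m<n⇒m<1+n i<k)) (f≗g k ≤-refl)

∑-cong : ∀ k {f g : ℕ → ℕ} → (∀ i → f i ≡ g i) → ∑[ i < k ] f i ≡ ∑[ i < k ] g i
∑-cong k f≗g = ∑-cong< k λ i _ → f≗g i

∑-distrib-+ : ∀ k (f g : ℕ → ℕ) → ∑[ i < k ] (f i + g i) ≡ ∑[ i < k ] f i + ∑[ i < k ] g i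
∑-distrib-+ zero    f g = refl
∑-distrib-+ (suc k) f g = begin
  ∑[ i < k ] (f i + g i) + (f k + g k)            ≡⟨ cong (_+ (f k + g k)) (∑-distrib-+ k f g) ⟩
  ∑[ i < k ] f i + ∑[ i < k ] g i + (f k + g k)   ≡⟨ +-+-interchange (∑[ i < k ] f i) _ (f k) (g k) ⟩
  ∑[ i < k ] f i + f k + (∑[ i < k ] g i + g k)   ∎
  where
  open ≡-Reasoning
  +-+-interchange : ∀ a b c d → a + b + (c + d) ≡ a + c + (b + d)
  +-+-interchange = solve-∀

∑-const : ∀ k c → ∑[ i < k ] c ≡ k * c
∑-const zero    c = refl
∑-const (suc k) c = trans (cong (_+ c) (∑-const k c)) (+-comm (k * c) c)

∑-*ʳ : ∀ k (f : ℕ → ℕ) c → ∑[ i < k ] (f i * c) ≡ (∑[ i < k ] f i) * c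
∑-*ʳ zero    f c = refl
∑-*ʳ (suc k) f c = trans (cong (_+ f k * c) (∑-*ʳ k f c)) (sym (*-distribʳ-+ c (∑[ i < k ] f i) (f k)))

∑-reverse : ∀ k (f : ℕ → ℕ) → ∑[ i < k ] f (k ∸ suc i) ≡ ∑[ i < k ] f i
∑-reverse zero    f = refl
∑-reverse (suc k) f = begin
  ∑[ i < suc k ] f (suc k ∸ suc i)   ≡⟨ ∑-cons k (λ i → f (suc k ∸ suc i)) ⟩
  f k + ∑[ i < k ] f (k ∸ suc i)     ≡⟨ cong (f k +_) (∑-reverse k f) ⟩
  f k + ∑[ i < k ] f i               ≡⟨ +-comm (f k) _ ⟩
  ∑[ i < suc k ] f i                 ∎
  where open ≡-Reasoning

∑-pairs : ∀ k (f : ℕ → ℕ) → ∑[ i < 2 * k ] f i ≡ ∑[ i < k ] (f (2 * i) + f (suc (2 * i)))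
∑-pairs zero    f = refl
∑-pairs (suc k) f = begin
  ∑[ i < 2 * suc k ] f i                              ≡⟨ cong (λ l → ∑[ i < l ] f i) (*-suc 2 k) ⟩
  ∑[ i < 2 * k ] f i + f (2 * k) + f (suc (2 * k))    ≡⟨ +-assoc (∑[ i < 2 * k ] f i) (f (2 * k)) _ ⟩
  ∑[ i < 2 * k ] f i + (f (2 * k) + f (suc (2 * k)))  ≡⟨ cong (_+ (f (2 * k) + f (suc (2 * k)))) (∑-pairs k f) ⟩
  ∑[ i < suc k ] (f (2 * i) + f (suc (2 * i)))        ∎
  where open ≡-Reasoning

∑[i<1+2k]i : ∀ k → ∑[ i < suc (2 * k) ] i ≡ k * suc (2 * k)
∑[i<1+2k]i zero    = refl
∑[i<1+2k]i (suc k) = begin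
  ∑[ i < suc (2 * suc k) ] i
    ≡⟨ cong (λ l → ∑[ i < suc l ] i) (*-suc 2 k) ⟩
  ∑[ i < suc (2 * k) ] i + suc (2 * k) + (2 + 2 * k)
    ≡⟨ cong (λ x → x + suc (2 * k) + (2 + 2 * k)) (∑[i<1+2k]i k) ⟩
  k * suc (2 * k) + suc (2 * k) + (2 + 2 * k)
    ≡⟨ step k ⟩
  suc k * suc (2 * suc k)
    ∎
  where
  open ≡-Reasoning
  step : ∀ k → k * suc (2 * k) + suc (2 * k) + (2 + 2 * k) ≡ suc k * suc (2 * suc k)
  step = solve-∀

-- Vertex sums of an arbitrary edge weighting

incidentWeight : ∀ {k} → Fin k → Fin k × Fin k → ℕ → ℕ
incidentWeight u ab x = if ⌊ u ≟ᶠ proj₁ ab ⌋ ∨ ⌊ u ≟ᶠ proj₂ ab ⌋ then x else 0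

-- vsum G f is weightSum G (label G f) by definition.
weightSum : (G : Graph) → (Fin (E G) → ℕ) → Fin (V G) → ℕ
weightSum G w u = sum (tabulate λ e → incidentWeight u (ends G e) (w e))

⌊⌋-true : ∀ {a} {A : Set a} (a? : Dec A) → A → ⌊ a? ⌋ ≡ true
⌊⌋-true a? a = trans (isYes≗does a?) (dec-true a? a)

⌊⌋-false : ∀ {a} {A : Set a} (a? : Dec A) → ¬ A → ⌊ a? ⌋ ≡ false
⌊⌋-false a? ¬a = trans (isYes≗does a?) (dec-false a? ¬a)

incidentWeight-hitˡ : ∀ {k} (u b : Fin k) x → incidentWeight u (u , b) x ≡ x
incidentWeight-hitˡ u b x rewrite ⌊⌋-true (u ≟ᶠ u) refl = refl

incidentWeight-hitʳ : ∀ {k} (u a : Fin k) x → incidentWeight u (a , u) x ≡ x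
incidentWeight-hitʳ u a x with ⌊ u ≟ᶠ a ⌋
... | true  = refl
... | false rewrite ⌊⌋-true (u ≟ᶠ u) refl = refl

incidentWeight-miss : ∀ {k} {u a b : Fin k} x → u ≢ a → u ≢ b → incidentWeight u (a , b) x ≡ 0
incidentWeight-miss {u = u} {a} {b} x u≢a u≢b
  rewrite ⌊⌋-false (u ≟ᶠ a) u≢a | ⌊⌋-false (u ≟ᶠ b) u≢b = refl

⌊≟⌋-map : ∀ {k l} (h : Fin k → Fin l) → (∀ {a b} → h a ≡ h b → a ≡ b) →
                  ∀ u a → ⌊ h u ≟ᶠ h a ⌋ ≡ ⌊ u ≟ᶠ a ⌋
⌊≟⌋-map h h-inj u a with u ≟ᶠ a
... | yes u≡a = ⌊⌋-true (h u ≟ᶠ h a) (cong h u≡a)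
... | no  u≢a = ⌊⌋-false (h u ≟ᶠ h a) (u≢a ∘ h-inj)

incidentWeight-map : ∀ {k l} (h : Fin k → Fin l) → (∀ {a b} → h a ≡ h b → a ≡ b) →
  ∀ u a b x → incidentWeight (h u) (h a , h b) x ≡ incidentWeight u (a , b) x
incidentWeight-map h h-inj u a b x
  rewrite ⌊≟⌋-map h h-inj u a | ⌊≟⌋-map h h-inj u b = refl

↑ˡ≢↑ʳ : ∀ {k l} (i : Fin k) (j : Fin l) → i ↑ˡ l ≢ k ↑ʳ j
↑ˡ≢↑ʳ {k} {l} i j eq
  with () ← trans (sym (splitAt-↑ˡ k i l)) (trans (cong (splitAt k) eq) (splitAt-↑ʳ k l j))

weightSum-cong : ∀ G {w w′ : Fin (E G) → ℕ} → (∀ e → w e ≡ w′ e) →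
                 ∀ u → weightSum G w u ≡ weightSum G w′ u
weightSum-cong G w≗w′ u = sum-tabulate-cong λ e → cong (incidentWeight u (ends G e)) (w≗w′ e)

-- Disjoint unions and joins

module _ (G H : Graph) where

  ends-⊕ˡ : ∀ e → ends (G ⊕ H) (e ↑ˡ E H) ≡ (proj₁ (ends G e) ↑ˡ V H , proj₂ (ends G e) ↑ˡ V H)
  ends-⊕ˡ e rewrite splitAt-↑ˡ (E G) e (E H) = refl

  ends-⊕ʳ : ∀ e → ends (G ⊕ H) (E G ↑ʳ e) ≡ (V G ↑ʳ proj₁ (ends H e) , V G ↑ʳ proj₂ (ends H e))
  ends-⊕ʳ e rewrite splitAt-↑ʳ (E G) (E H) e = refl

  weightSum-⊕ˡ : ∀ w u → weightSum (G ⊕ H) w (u ↑ˡ V H) ≡ weightSum G (w ∘ (_↑ˡ E H)) u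
  weightSum-⊕ˡ w u = trans (sum-tabulate-↑ (E G) (E H) _)
    (trans (cong₂ _+_ (sum-tabulate-cong own) (sum-tabulate-zero other)) (+-identityʳ _))
    where
    own : ∀ e → incidentWeight (u ↑ˡ V H) (ends (G ⊕ H) (e ↑ˡ E H)) (w (e ↑ˡ E H))
              ≡ incidentWeight u (ends G e) (w (e ↑ˡ E H))
    own e rewrite ends-⊕ˡ e =
      incidentWeight-map (_↑ˡ V H) (↑ˡ-injective (V H) _ _) u (proj₁ (ends G e)) (proj₂ (ends G e)) _
    other : ∀ e → incidentWeight (u ↑ˡ V H) (ends (G ⊕ H) (E G ↑ʳ e)) (w (E G ↑ʳ e)) ≡ 0
    other e rewrite ends-⊕ʳ e =
      incidentWeight-miss _ (↑ˡ≢↑ʳ u (proj₁ (ends H e))) (↑ˡ≢↑ʳ u (proj₂ (ends H e)))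

  weightSum-⊕ʳ : ∀ w u → weightSum (G ⊕ H) w (V G ↑ʳ u) ≡ weightSum H (w ∘ (E G ↑ʳ_)) u
  weightSum-⊕ʳ w u = trans (sum-tabulate-↑ (E G) (E H) _)
    (cong₂ _+_ (sum-tabulate-zero other) (sum-tabulate-cong own))
    where
    own : ∀ e → incidentWeight (V G ↑ʳ u) (ends (G ⊕ H) (E G ↑ʳ e)) (w (E G ↑ʳ e))
              ≡ incidentWeight u (ends H e) (w (E G ↑ʳ e))
    own e rewrite ends-⊕ʳ e =
      incidentWeight-map (V G ↑ʳ_) (↑ʳ-injective (V G) _ _) u (proj₁ (ends H e)) (proj₂ (ends H e)) _
    other : ∀ e → incidentWeight (V G ↑ʳ u) (ends (G ⊕ H) (e ↑ˡ E H)) (w (e ↑ˡ E H)) ≡ 0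
    other e rewrite ends-⊕ˡ e =
      incidentWeight-miss _ (↑ˡ≢↑ʳ (proj₁ (ends G e)) u ∘ sym) (↑ˡ≢↑ʳ (proj₂ (ends G e)) u ∘ sym)

  ∨-inner : Fin (E G + E H) → Fin (E (G ∨G H))
  ∨-inner e = e ↑ˡ V G * V H

  ∨-cross : Fin (V G) → Fin (V H) → Fin (E (G ∨G H))
  ∨-cross i k = (E G + E H) ↑ʳ combine i k

  ends-∨-inner : ∀ e → ends (G ∨G H) (∨-inner e) ≡ ends (G ⊕ H) e
  ends-∨-inner e rewrite splitAt-↑ˡ (E G + E H) e (V G * V H) = refl

  ends-∨-cross : ∀ i k → ends (G ∨G H) (∨-cross i k) ≡ (i ↑ˡ V H , V G ↑ʳ k)
  ends-∨-cross i k rewrite splitAt-↑ʳ (E G + E H) (V G * V H) (combine i k) =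
    cong (λ ik → (proj₁ ik ↑ˡ V H , V G ↑ʳ proj₂ ik)) (remQuot-combine i k)

  weightSum-∨ : ∀ w u → weightSum (G ∨G H) w u ≡ weightSum (G ⊕ H) (w ∘ ∨-inner) u
    + sum (tabulate λ i → sum (tabulate λ k → incidentWeight u (i ↑ˡ V H , V G ↑ʳ k) (w (∨-cross i k))))
  weightSum-∨ w u = trans (sum-tabulate-↑ (E G + E H) (V G * V H) _)
    (cong₂ _+_ (sum-tabulate-cong λ e → cong (λ ab → incidentWeight u ab (w (∨-inner e))) (ends-∨-inner e))
               (trans (sum-tabulate-combine (V G) (V H) _)
                      (sum-tabulate-cong λ i → sum-tabulate-cong λ k →
                        cong (λ ab → incidentWeight u ab (w (∨-cross i k))) (ends-∨-cross i k))))

  weightSum-∨ˡ : ∀ w i → weightSum (G ∨G H) w (i ↑ˡ V H)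
                       ≡ weightSum G (w ∘ ∨-inner ∘ (_↑ˡ E H)) i + sum (tabulate (w ∘ ∨-cross i))
  weightSum-∨ˡ w i = trans (weightSum-∨ w (i ↑ˡ V H))
    (cong₂ _+_ (weightSum-⊕ˡ (w ∘ ∨-inner) i)
               (trans (sum-tabulate-single _ i other) (sum-tabulate-cong own)))
    where
    own : ∀ k → incidentWeight (i ↑ˡ V H) (i ↑ˡ V H , V G ↑ʳ k) (w (∨-cross i k)) ≡ w (∨-cross i k)
    own k = incidentWeight-hitˡ (i ↑ˡ V H) (V G ↑ʳ k) _
    other : ∀ i′ → i′ ≢ i →
      sum (tabulate λ k → incidentWeight (i ↑ˡ V H) (i′ ↑ˡ V H , V G ↑ʳ k) (w (∨-cross i′ k))) ≡ 0
    other i′ i′≢i = sum-tabulate-zero λ k →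
      incidentWeight-miss _ (i′≢i ∘ sym ∘ ↑ˡ-injective (V H) i i′) (↑ˡ≢↑ʳ i k)

  weightSum-∨ʳ : ∀ w k → weightSum (G ∨G H) w (V G ↑ʳ k)
                       ≡ weightSum H (w ∘ ∨-inner ∘ (E G ↑ʳ_)) k + sum (tabulate λ i → w (∨-cross i k))
  weightSum-∨ʳ w k = trans (weightSum-∨ w (V G ↑ʳ k))
    (cong₂ _+_ (weightSum-⊕ʳ (w ∘ ∨-inner) k)
               (sum-tabulate-cong λ i → trans (sum-tabulate-single _ k (other i)) (own i)))
    where
    own : ∀ i → incidentWeight (V G ↑ʳ k) (i ↑ˡ V H , V G ↑ʳ k) (w (∨-cross i k)) ≡ w (∨-cross i k)
    own i = incidentWeight-hitʳ (V G ↑ʳ k) (i ↑ˡ V H) _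
    other : ∀ i k′ → k′ ≢ k → incidentWeight (V G ↑ʳ k) (i ↑ˡ V H , V G ↑ʳ k′) (w (∨-cross i k′)) ≡ 0
    other i k′ k′≢k = incidentWeight-miss _ (↑ˡ≢↑ʳ i k ∘ sym) (k′≢k ∘ sym ∘ ↑ʳ-injective (V G) k k′)

  joinWeight : (Fin (E G + E H) → ℕ) → (Fin (V G) → Fin (V H) → ℕ) → Fin (E (G ∨G H)) → ℕ
  joinWeight wᵢ wₓ = [ wᵢ , uncurry wₓ ∘ remQuot (V H) ]′ ∘ splitAt (E G + E H)

  joinWeight-inner : ∀ wᵢ wₓ e → joinWeight wᵢ wₓ (∨-inner e) ≡ wᵢ e
  joinWeight-inner wᵢ wₓ e rewrite splitAt-↑ˡ (E G + E H) e (V G * V H) = refl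

  joinWeight-cross : ∀ wᵢ wₓ i k → joinWeight wᵢ wₓ (∨-cross i k) ≡ wₓ i k
  joinWeight-cross wᵢ wₓ i k rewrite splitAt-↑ʳ (E G + E H) (V G * V H) (combine i k) =
    cong (uncurry wₓ) (remQuot-combine i k)

  data JoinEdge : Fin (E (G ∨G H)) → Set where
    inner : ∀ e → JoinEdge (∨-inner e)
    cross : ∀ i k → JoinEdge (∨-cross i k)

  joinEdge : ∀ e → JoinEdge e
  joinEdge e with split (E G + E H) (V G * V H) e
  ... | left e′ = inner e′
  ... | right p =
    subst (JoinEdge ∘ ((E G + E H) ↑ʳ_)) (combine-remQuot {V G} (V H) p) (uncurry cross (remQuot (V H) p))

odd : ℕ → Bool
odd zero          = false
odd (suc zero)    = true
odd (suc (suc n)) = odd n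

odd-2* : ∀ n → odd (2 * n) ≡ false
odd-2* zero    = refl
odd-2* (suc n) = trans (cong odd (*-suc 2 n)) (odd-2* n)

odd-1+2* : ∀ n → odd (suc (2 * n)) ≡ true
odd-1+2* zero    = refl
odd-1+2* (suc n) = trans (cong (odd ∘ suc) (*-suc 2 n)) (odd-1+2* n)

⌊2*n/2⌋≡n : ∀ n → ⌊ 2 * n /2⌋ ≡ n
⌊2*n/2⌋≡n zero    = refl
⌊2*n/2⌋≡n (suc n) = trans (cong ⌊_/2⌋ (*-suc 2 n)) (cong suc (⌊2*n/2⌋≡n n))

⌊1+2*n/2⌋≡n : ∀ n → ⌊ suc (2 * n) /2⌋ ≡ n
⌊1+2*n/2⌋≡n zero    = refl
⌊1+2*n/2⌋≡n (suc n) = trans (cong (⌊_/2⌋ ∘ suc) (*-suc 2 n)) (cong suc (⌊1+2*n/2⌋≡n n))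

⌊n/2⌋-odd-injective : ∀ m n → ⌊ m /2⌋ ≡ ⌊ n /2⌋ → odd m ≡ odd n → m ≡ n
⌊n/2⌋-odd-injective zero          zero          _  _    = refl
⌊n/2⌋-odd-injective (suc zero)    (suc zero)    _  _    = refl
⌊n/2⌋-odd-injective (suc (suc m)) (suc (suc n)) eq odd≡ =
  cong (2 +_) (⌊n/2⌋-odd-injective m n (suc-injective eq) odd≡)
⌊n/2⌋-odd-injective zero          (suc zero)    _  ()
⌊n/2⌋-odd-injective (suc zero)    zero          _  ()
⌊n/2⌋-odd-injective zero          (suc (suc n)) () _
⌊n/2⌋-odd-injective (suc (suc m)) zero          () _
⌊n/2⌋-odd-injective (suc zero)    (suc (suc n)) () _
⌊n/2⌋-odd-injective (suc (suc m)) (suc zero)    () _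

xor-cancelʳ : ∀ x y z → x xor z ≡ y xor z → x ≡ y
xor-cancelʳ false false _     _  = refl
xor-cancelʳ true  true  _     _  = refl
xor-cancelʳ false true  false ()
xor-cancelʳ false true  true  ()
xor-cancelʳ true  false false ()
xor-cancelʳ true  false true  ()

⌊n/2⌋<m : ∀ n m → n < 2 * m → ⌊ n /2⌋ < m
⌊n/2⌋<m n zero n<0 = contradiction n<0 (λ ())
⌊n/2⌋<m zero          (suc m) _ = z<s
⌊n/2⌋<m (suc zero)    (suc m) _ = z<s
⌊n/2⌋<m (suc (suc n)) (suc m) n<2m rewrite *-suc 2 m = s<s (⌊n/2⌋<m n m (s<s⁻¹ (s<s⁻¹ n<2m)))

-- Perfect matchings

weightSum-matching : ∀ k (f : ℕ → ℕ) v → weightSum (copies k P2) (f ∘ toℕ) v ≡ f ⌊ toℕ v /2⌋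
weightSum-matching (suc k) f zero          =
  trans (weightSum-⊕ˡ P2 (copies k P2) (f ∘ toℕ) zero) (+-identityʳ (f 0))
weightSum-matching (suc k) f (suc zero)    =
  trans (weightSum-⊕ˡ P2 (copies k P2) (f ∘ toℕ) (suc zero)) (+-identityʳ (f 0))
weightSum-matching (suc k) f (suc (suc v)) =
  trans (weightSum-⊕ʳ P2 (copies k P2) (f ∘ toℕ) v) (weightSum-matching k (f ∘ suc) v)

ends-matching : ∀ k e → toℕ (proj₁ (ends (copies k P2) e)) ≡ 2 * toℕ e
                      × toℕ (proj₂ (ends (copies k P2) e)) ≡ suc (2 * toℕ e)
ends-matching (suc k) zero    = refl , refl
ends-matching (suc k) (suc e) with ends-matching k e
... | first , second = trans (cong (2 +_) first) (sym (*-suc 2 (toℕ e)))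
                     , trans (cong (2 +_) second) (cong suc (sym (*-suc 2 (toℕ e))))

E-matching : ∀ k → E (copies k P2) ≡ k
E-matching zero    = refl
E-matching (suc k) = cong suc (E-matching k)

V-matching : ∀ k → V (copies k P2) ≡ 2 * k
V-matching zero    = refl
V-matching (suc k) = trans (cong (2 +_) (V-matching k)) (sym (*-suc 2 k))

-- Counting colours

∈-─ : ∀ {x y : ℕ} {ys} (x∈ys : x ∈ ys) → y ∈ ys → y ≢ x → y ∈ (ys ─ x∈ys)
∈-─ (here refl)  (here refl)  y≢x = contradiction refl y≢x
∈-─ (here refl)  (there y∈ys) y≢x = y∈ys
∈-─ (there x∈ys) (here refl)  y≢x = here refl
∈-─ (there x∈ys) (there y∈ys) y≢x = there (∈-─ x∈ys y∈ys y≢x)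

length-≤-⊆ : ∀ {xs ys : List ℕ} → Unique xs → xs ⊆ ys → length xs ≤ length ys
length-≤-⊆ {[]}     {ys} _              _     = z≤n
length-≤-⊆ {x ∷ xs} {ys} (x∉xs ∷ !xs) xs⊆ys =
  subst (suc (length xs) ≤_) (sym (length-removeAt′ ys (index x∈ys))) (s≤s (length-≤-⊆ !xs xs⊆ys─x))
  where
  x∈ys = xs⊆ys (here refl)
  xs⊆ys─x : xs ⊆ (ys ─ x∈ys)
  xs⊆ys─x y∈xs = ∈-─ x∈ys (xs⊆ys (there y∈xs)) (λ y≡x → All.lookup x∉xs y∈xs (sym y≡x))

module _ (G : Graph) (f : Labeling G) where

  colours : List ℕ
  colours = deduplicate _≟_ (tabulate (vsum G f))

  ∈-colours : ∀ v → vsum G f v ∈ colours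
  ∈-colours v = Equivalence.to (deduplicate-∈⇔ _≟_) (∈-tabulate⁺ v)

  numColors-≤ : ∀ (xs : List ℕ) → (∀ v → vsum G f v ∈ xs) → numColors G f ≤ length xs
  numColors-≤ xs sums∈xs = length-≤-⊆ (deduplicate-! _≟_ (tabulate (vsum G f))) colours⊆xs
    where
    colours⊆xs : colours ⊆ xs
    colours⊆xs x∈colours with v , refl ← ∈-tabulate⁻ (Equivalence.from (deduplicate-∈⇔ _≟_) x∈colours) =
      sums∈xs v

  numColors-≥ : ∀ (xs : List ℕ) → Unique xs → (∀ {x} → x ∈ xs → ∃[ v ] vsum G f v ≡ x) →
                length xs ≤ numColors G f
  numColors-≥ xs !xs attained = length-≤-⊆ !xs xs⊆colours
    where
    xs⊆colours : xs ⊆ colours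
    xs⊆colours x∈xs with v , refl ← attained x∈xs = ∈-colours v

  triangle⇒3≤numColors : IsLocalAntimagic G f → ∀ {x y z} e₁ e₂ e₃ →
    ends G e₁ ≡ (x , y) → ends G e₂ ≡ (x , z) → ends G e₃ ≡ (y , z) → 3 ≤ numColors G f
  triangle⇒3≤numColors antimagic {x} {y} {z} e₁ e₂ e₃ e₁≡xy e₂≡xz e₃≡yz =
    numColors-≥ (vsum G f x ∷ vsum G f y ∷ vsum G f z ∷ [])
      ((distinct e₁≡xy ∷ distinct e₂≡xz ∷ []) ∷ (distinct e₃≡yz ∷ []) ∷ [] ∷ [])
      attained
    where
    distinct : ∀ {e a b} → ends G e ≡ (a , b) → vsum G f a ≢ vsum G f b
    distinct {e} refl = antimagic e
    attained : ∀ {s} → s ∈ vsum G f x ∷ vsum G f y ∷ vsum G f z ∷ [] → ∃[ v ] vsum G f v ≡ s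
    attained (here refl)                 = x , refl
    attained (there (here refl))         = y , refl
    attained (there (there (here refl))) = z , refl

-- Labelings from injective weightings

injective⇒surjective : ∀ {k} (f : Fin k → Fin k) → Injective _≡_ _≡_ f → Surjective _≡_ _≡_ f
injective⇒surjective {suc k} f f-inj y with any? (λ x → f x ≟ᶠ y)
... | yes (x , fx≡y) = x , λ { refl → fx≡y }
... | no  missed     = contradiction (injective⇒≤ punched-injective) (n≮n k)
  where
  y≢f : ∀ x → y ≢ f x
  y≢f x y≡fx = missed (x , sym y≡fx)
  punched : Fin (suc k) → Fin k
  punched x = punchOut (y≢f x)
  punched-injective : Injective _≡_ _≡_ punched
  punched-injective {x} {x′} = f-inj ∘ punchOut-injective (y≢f x) (y≢f x′)

labelingFrom : ∀ {k} (w : Fin k → ℕ) → (∀ e → w e < k) → Injective _≡_ _≡_ w → Fin k ⤖ Fin k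
labelingFrom w w<k w-inj = mk⤖ (to-injective , injective⇒surjective to to-injective)
  where
  to = λ e → fromℕ< (w<k e)
  to-injective : Injective _≡_ _≡_ to
  to-injective {e} {e′} eq =
    w-inj (trans (sym (toℕ-fromℕ< (w<k e))) (trans (cong toℕ eq) (toℕ-fromℕ< (w<k e′))))

label-labelingFrom : ∀ G (w : Fin (E G) → ℕ) (w<E : ∀ e → w e < E G) (w-inj : Injective _≡_ _≡_ w) →
                     ∀ e → label G (labelingFrom w w<E w-inj) e ≡ suc (w e)
label-labelingFrom G w w<E w-inj e = cong suc (toℕ-fromℕ< (w<E e))

-- Proper weightings and disjoint copies

Proper : (G : Graph) → (Fin (E G) → ℕ) → Set
Proper G w = ∀ e → weightSum G w (proj₁ (ends G e)) ≢ weightSum G w (proj₂ (ends G e))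

proper-at : ∀ G w e {a b} → ends G e ≡ (a , b) → weightSum G w a ≢ weightSum G w b →
            weightSum G w (proj₁ (ends G e)) ≢ weightSum G w (proj₂ (ends G e))
proper-at G w e refl a≢b = a≢b

proper-cong : ∀ G {w w′ : Fin (E G) → ℕ} → (∀ e → w e ≡ w′ e) → Proper G w → Proper G w′
proper-cong G w≗w′ proper e eq = proper e
  (trans (weightSum-cong G w≗w′ (proj₁ (ends G e))) (trans eq (sym (weightSum-cong G w≗w′ (proj₂ (ends G e))))))

proper-⊕ : ∀ G H (w : Fin (E (G ⊕ H)) → ℕ) →
  Proper G (w ∘ (_↑ˡ E H)) → Proper H (w ∘ (E G ↑ʳ_)) → Proper (G ⊕ H) w
proper-⊕ G H w properG properH e with split (E G) (E H) e
... | left e′ rewrite ends-⊕ˡ G H e′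
                    | weightSum-⊕ˡ G H w (proj₁ (ends G e′))
                    | weightSum-⊕ˡ G H w (proj₂ (ends G e′)) = properG e′
... | right e′ rewrite ends-⊕ʳ G H e′
                     | weightSum-⊕ʳ G H w (proj₁ (ends H e′))
                     | weightSum-⊕ʳ G H w (proj₂ (ends H e′)) = properH e′

module _ (H : Graph) where

  copiesWeight : (ℕ → Fin (E H) → ℕ) → ∀ r → Fin (E (copies r H)) → ℕ
  copiesWeight w zero    = λ ()
  copiesWeight w (suc r) = [ w 0 , copiesWeight (w ∘ suc) r ]′ ∘ splitAt (E H)

  copiesWeight-↑ˡ : ∀ w r e → copiesWeight w (suc r) (e ↑ˡ E (copies r H)) ≡ w 0 e
  copiesWeight-↑ˡ w r e rewrite splitAt-↑ˡ (E H) e (E (copies r H)) = refl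

  copiesWeight-↑ʳ : ∀ w r e → copiesWeight w (suc r) (E H ↑ʳ e) ≡ copiesWeight (w ∘ suc) r e
  copiesWeight-↑ʳ w r e rewrite splitAt-↑ʳ (E H) (E (copies r H)) e = refl

  copiesWeight-map : ∀ (f : ℕ → ℕ) w r e → copiesWeight (λ j → f ∘ w j) r e ≡ f (copiesWeight w r e)
  copiesWeight-map f w (suc r) e with split (E H) (E (copies r H)) e
  ... | left e′  = trans (copiesWeight-↑ˡ (λ j → f ∘ w j) r e′) (sym (cong f (copiesWeight-↑ˡ w r e′)))
  ... | right e′ = trans (copiesWeight-↑ʳ (λ j → f ∘ w j) r e′)
                         (trans (copiesWeight-map f (w ∘ suc) r e′) (sym (cong f (copiesWeight-↑ʳ w r e′))))

  copiesWeight-image : ∀ w r e → ∃[ j ] j < r × ∃[ e₀ ] copiesWeight w r e ≡ w j e₀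
  copiesWeight-image w (suc r) e with split (E H) (E (copies r H)) e
  ... | left e′  = 0 , z<s , e′ , copiesWeight-↑ˡ w r e′
  ... | right e′ with j , j<r , e₀ , eq ← copiesWeight-image (w ∘ suc) r e′ =
    suc j , s<s j<r , e₀ , trans (copiesWeight-↑ʳ w r e′) eq

  copiesWeight-injective : ∀ w r →
    (∀ {j j′ e e′} → j < r → j′ < r → w j e ≡ w j′ e′ → j ≡ j′ × e ≡ e′) →
    Injective _≡_ _≡_ (copiesWeight w r)
  copiesWeight-injective w (suc r) w-inj {e₁} {e₂} eq
    with split (E H) (E (copies r H)) e₁ | split (E H) (E (copies r H)) e₂
  ... | left e₁′ | left e₂′ = cong (_↑ˡ E (copies r H)) (proj₂ (w-inj z<s z<s
          (trans (sym (copiesWeight-↑ˡ w r e₁′)) (trans eq (copiesWeight-↑ˡ w r e₂′)))))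
  ... | right e₁′ | right e₂′ = cong (E H ↑ʳ_) (copiesWeight-injective (w ∘ suc) r
          (λ j<r j′<r eq′ → map suc-injective id (w-inj (s<s j<r) (s<s j′<r) eq′))
          (trans (sym (copiesWeight-↑ʳ w r e₁′)) (trans eq (copiesWeight-↑ʳ w r e₂′))))
  ... | left e₁′ | right e₂′ with j , j<r , e₀ , eq₂ ← copiesWeight-image (w ∘ suc) r e₂′ =
    contradiction (proj₁ (w-inj z<s (s<s j<r) w0≡wj)) 0≢1+n
    where
    w0≡wj = trans (sym (copiesWeight-↑ˡ w r e₁′)) (trans eq (trans (copiesWeight-↑ʳ w r e₂′) eq₂))
  ... | right e₁′ | left e₂′ with j , j<r , e₀ , eq₁ ← copiesWeight-image (w ∘ suc) r e₁′ =
    contradiction (proj₁ (w-inj z<s (s<s j<r) w0≡wj)) 0≢1+n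
    where
    w0≡wj = trans (sym (copiesWeight-↑ˡ w r e₂′)) (trans (sym eq) (trans (copiesWeight-↑ʳ w r e₁′) eq₁))

  proper-copies : ∀ w r → (∀ j → j < r → Proper H (w j)) → Proper (copies r H) (copiesWeight w r)
  proper-copies w (suc r) proper = proper-⊕ H (copies r H) (copiesWeight w (suc r))
    (proper-cong H (sym ∘ copiesWeight-↑ˡ w r) (proper 0 z<s))
    (proper-cong (copies r H) (sym ∘ copiesWeight-↑ʳ w r)
      (proper-copies (w ∘ suc) r λ j j<r → proper (suc j) (s<s j<r)))

  E-copies : ∀ r → E (copies r H) ≡ r * E H
  E-copies zero    = refl
  E-copies (suc r) = cong (E H +_) (E-copies r)

  copiesWeight-< : ∀ w r {b} → (∀ j → j < r → ∀ e → w j e < b) → ∀ e → copiesWeight w r e < b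
  copiesWeight-< w r w<b e with j , j<r , e₀ , eq ← copiesWeight-image w r e =
    subst (_< _) (sym eq) (w<b j j<r e₀)

  weightSum-first-copy : ∀ w r v →
    weightSum (copies (suc r) H) (copiesWeight w (suc r)) (v ↑ˡ V (copies r H)) ≡ weightSum H (w 0) v
  weightSum-first-copy w r v =
    trans (weightSum-⊕ˡ H (copies r H) (copiesWeight w (suc r)) v) (weightSum-cong H (copiesWeight-↑ˡ w r) v)

  weightSum-copies : ∀ w r v → ∃[ j ] j < r × ∃[ v₀ ]
                     weightSum (copies r H) (copiesWeight w r) v ≡ weightSum H (w j) v₀
  weightSum-copies w (suc r) v with split (V H) (V (copies r H)) v
  ... | left v′ = 0 , z<s , v′ , weightSum-first-copy w r v′
  ... | right v′ with j , j<r , v₀ , eq ← weightSum-copies (w ∘ suc) r v′ = suc j , s<s j<r , v₀ ,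
    trans (weightSum-⊕ʳ H (copies r H) (copiesWeight w (suc r)) v′)
          (trans (weightSum-cong (copies r H) (copiesWeight-↑ʳ w r) v′) eq)

divMod-unique : ∀ d {j j′ a a′} → a < d → a′ < d → j * d + a ≡ j′ * d + a′ → j ≡ j′ × a ≡ a′
divMod-unique d {zero}  {zero}   a<d a′<d eq = refl , eq
divMod-unique d {zero}  {suc j′} a<d a′<d eq =
  contradiction (≤-trans (m≤m+n d (j′ * d)) (≤-trans (m≤m+n _ _) (≤-reflexive (sym eq)))) (<⇒≱ a<d)
divMod-unique d {suc j} {zero}   a<d a′<d eq =
  contradiction (≤-trans (m≤m+n d (j * d)) (≤-trans (m≤m+n _ _) (≤-reflexive eq))) (<⇒≱ a′<d)
divMod-unique d {suc j} {suc j′} a<d a′<d eq =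
  map (cong suc) id (divMod-unique d a<d a′<d
    (+-cancelˡ-≡ d _ _ (trans (sym (+-assoc d _ _)) (trans eq (+-assoc d _ _)))))

P*k+y<P*l+c : ∀ P {k l y c} → k < l → y ≤ suc P → 1 < c → P * k + y < P * l + c
P*k+y<P*l+c P {k} {l} {y} {c} k<l y≤1+P 1<c = begin-strict
  P * k + y        ≤⟨ +-monoʳ-≤ (P * k) y≤1+P ⟩
  P * k + suc P    ≡⟨ cong (P * k +_) (+-comm 1 P) ⟩
  P * k + (P + 1)  <⟨ +-monoʳ-< (P * k) (+-monoʳ-< P 1<c) ⟩
  P * k + (P + c)  ≡⟨ sym (+-assoc (P * k) P c) ⟩
  P * k + P + c    ≡⟨ cong (_+ c) (trans (+-comm (P * k) P) (sym (*-suc P k))) ⟩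
  P * suc k + c    ≤⟨ +-monoˡ-≤ c (*-monoʳ-≤ P k<l) ⟩
  P * l + c        ∎
  where open ≤-Reasoning

-- The labeling of r ((2s) P₂ ∨ O_m)

module Construction (n s′ r′ : ℕ) where

  open ≡-Reasoning

  m = 2 * n + 1
  s = suc s′
  r = suc r′
  M = r * s
  T = M + M

  reflect : Bool → ℕ → ℕ
  reflect false ℓ = ℓ
  reflect true  ℓ = T ∸ suc ℓ

  reflect-pair : ∀ b {ℓ} → ℓ < T → suc (reflect b ℓ + reflect (not b) ℓ) ≡ T
  reflect-pair false ℓ<T = m+[n∸m]≡n ℓ<T
  reflect-pair true  {ℓ} ℓ<T = trans (cong suc (+-comm (T ∸ suc ℓ) ℓ)) (m+[n∸m]≡n ℓ<T)

  reflect-< : ∀ b {ℓ} → ℓ < T → reflect b ℓ < T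
  reflect-< false ℓ<T = ℓ<T
  reflect-< true  ℓ<T = ∸-monoʳ-< z<s ℓ<T

  M≤reflect : ∀ {ℓ} → ℓ < M → M ≤ reflect true ℓ
  M≤reflect ℓ<M = m+n≤o⇒m≤o∸n M (+-monoʳ-≤ M ℓ<M)

  reflect-injective : ∀ b b′ {ℓ ℓ′} → ℓ < M → ℓ′ < M → reflect b ℓ ≡ reflect b′ ℓ′ → b ≡ b′ × ℓ ≡ ℓ′
  reflect-injective false false ℓ<M ℓ′<M eq = refl , eq
  reflect-injective true  true  ℓ<M ℓ′<M eq =
    refl , suc-injective (∸-cancelˡ-≡ (≤-trans ℓ<M (m≤m+n M M)) (≤-trans ℓ′<M (m≤m+n M M)) eq)
  reflect-injective false true  ℓ<M ℓ′<M eq = contradiction (subst (M ≤_) (sym eq) (M≤reflect ℓ′<M)) (<⇒≱ ℓ<M)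
  reflect-injective true  false ℓ<M ℓ′<M eq = contradiction (subst (M ≤_) eq (M≤reflect ℓ<M)) (<⇒≱ ℓ′<M)

  slot : ℕ → ℕ → ℕ
  slot j t = j * s + ⌊ t /2⌋

  position-< : ∀ {j a} → j < r → a < s → j * s + a < M
  position-< {j} j<r a<s = <-≤-trans (+-monoʳ-< (j * s) a<s) (subst (_≤ M) (+-comm s (j * s)) (*-monoˡ-≤ s j<r))

  position-<T : ∀ {j a} → j < r → a < s → j * s + a < T
  position-<T j<r a<s = ≤-trans (position-< j<r a<s) (m≤m+n M M)

  slot-< : ∀ {j t} → j < r → t < 2 * s → slot j t < M
  slot-< {t = t} j<r t<2s = position-< j<r (⌊n/2⌋<m t s t<2s)

  slot-<T : ∀ {j t} → j < r → t < 2 * s → slot j t < T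
  slot-<T {t = t} j<r t<2s = position-<T j<r (⌊n/2⌋<m t s t<2s)

  slot-injective : ∀ {j j′ t t′} → t < 2 * s → t′ < 2 * s → slot j t ≡ slot j′ t′ → j ≡ j′ × ⌊ t /2⌋ ≡ ⌊ t′ /2⌋
  slot-injective {t = t} {t′} t<2s t′<2s = divMod-unique s (⌊n/2⌋<m t s t<2s) (⌊n/2⌋<m t′ s t′<2s)

  block : Bool → ℕ → ℕ
  block false i = i
  block true  i = m + (m ∸ suc i)

  block-< : ∀ b {i} → i < m → block b i < m + m
  block-< false i<m = ≤-trans i<m (m≤m+n m m)
  block-< true  i<m = +-monoʳ-< m (∸-monoʳ-< z<s i<m)

  block-injective : ∀ b b′ {i i′} → i < m → i′ < m → block b i ≡ block b′ i′ → b ≡ b′ × i ≡ i′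
  block-injective false false i<m i′<m eq = refl , eq
  block-injective true  true  i<m i′<m eq = refl , suc-injective (∸-cancelˡ-≡ i<m i′<m (+-cancelˡ-≡ m _ _ eq))
  block-injective false true  i<m i′<m eq = contradiction (subst (m ≤_) (sym eq) (m≤m+n m _)) (<⇒≱ i<m)
  block-injective true  false i<m i′<m eq = contradiction (subst (m ≤_) eq (m≤m+n m _)) (<⇒≱ i′<m)

  matchingLabel : ℕ → ℕ → ℕ
  matchingLabel j t = reflect (not (odd t)) (slot j t)

  crossLabel : ℕ → ℕ → Bool → ℕ → ℕ
  crossLabel j t b i = T + block b i * T + reflect (odd t xor odd i) (slot j t)

  -- Adding k on both sides avoids truncated subtraction: the reflections pair up to T − 1.
  ∑-reflect-alternating : ∀ h {ℓ} k → ℓ < T →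
    ∑[ i < suc (2 * k) ] reflect (h xor odd i) ℓ + k ≡ k * T + reflect h ℓ
  ∑-reflect-alternating h {ℓ} zero    ℓ<T = trans (+-identityʳ _) (cong (λ b → reflect b ℓ) (xor-identityʳ h))
  ∑-reflect-alternating h {ℓ} (suc k) ℓ<T = begin
    ∑[ i < suc (2 * suc k) ] f i + suc k
      ≡⟨ cong (λ l → ∑[ i < suc l ] f i + suc k) (*-suc 2 k) ⟩
    ∑[ i < suc (2 * k) ] f i + f (suc (2 * k)) + f (2 + 2 * k) + suc k
      ≡⟨ cong₂ (λ a b → ∑[ i < suc (2 * k) ] f i + reflect (h xor a) ℓ + reflect (h xor b) ℓ + suc k)
               (odd-1+2* k) (odd-2* k) ⟩
    ∑[ i < suc (2 * k) ] f i + reflect (h xor true) ℓ + reflect (h xor false) ℓ + suc k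
      ≡⟨ cong₂ (λ a b → ∑[ i < suc (2 * k) ] f i + reflect a ℓ + reflect b ℓ + suc k)
               (trans (xor-comm h true) (true-xor h)) (xor-identityʳ h) ⟩
    ∑[ i < suc (2 * k) ] f i + reflect (not h) ℓ + reflect h ℓ + suc k
      ≡⟨ regroup (∑[ i < suc (2 * k) ] f i) (reflect (not h) ℓ) (reflect h ℓ) k ⟩
    (∑[ i < suc (2 * k) ] f i + k) + suc (reflect h ℓ + reflect (not h) ℓ)
      ≡⟨ cong₂ _+_ (∑-reflect-alternating h k ℓ<T) (reflect-pair h ℓ<T) ⟩
    k * T + reflect h ℓ + T
      ≡⟨ +-comm-last (k * T) (reflect h ℓ) T ⟩
    suc k * T + reflect h ℓ
      ∎
    where
    f = λ i → reflect (h xor odd i) ℓ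
    regroup : ∀ a b c k → a + b + c + suc k ≡ (a + k) + suc (c + b)
    regroup = solve-∀
    +-comm-last : ∀ a b c → a + b + c ≡ c + a + b
    +-comm-last = solve-∀

  m≡1+2n : m ≡ suc (2 * n)
  m≡1+2n = +-comm (2 * n) 1

  ∑-block : Bool → ℕ
  ∑-block b = ∑[ i < m ] block b i

  ∑-block-false : ∑-block false ≡ n * m
  ∑-block-false = subst (λ l → ∑[ i < l ] i ≡ n * l) (sym m≡1+2n) (∑[i<1+2k]i n)

  ∑-block-true : ∑-block true ≡ m * m + n * m
  ∑-block-true = begin
    ∑[ i < m ] (m + (m ∸ suc i))            ≡⟨ ∑-distrib-+ m (λ _ → m) (λ i → m ∸ suc i) ⟩
    ∑[ i < m ] m + ∑[ i < m ] (m ∸ suc i)   ≡⟨ cong₂ _+_ (∑-const m m) (∑-reverse m (λ i → i)) ⟩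
    m * m + ∑-block false                   ≡⟨ cong (m * m +_) ∑-block-false ⟩
    m * m + n * m                           ∎

  sumK : ℕ → ℕ → Bool → ℕ
  sumK j t b = suc (matchingLabel j t) + ∑[ i < m ] suc (crossLabel j t b i)

  sumK-+n : ∀ {j t} b → j < r → t < 2 * s → sumK j t b + n ≡ T + m * suc T + ∑-block b * T + n * T
  sumK-+n {j} {t} b j<r t<2s = begin
    suc ρ̄ + ∑[ i < m ] (suc (T + block b i * T) + ρ i) + n
      ≡⟨ cong (λ x → suc ρ̄ + x + n) (∑-distrib-+ m (λ i → suc (T + block b i * T)) ρ) ⟩
    suc ρ̄ + (∑[ i < m ] (suc T + block b i * T) + ∑[ i < m ] ρ i) + n
      ≡⟨ cong (λ x → suc ρ̄ + (x + ∑[ i < m ] ρ i) + n) ∑-blocks ⟩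
    suc ρ̄ + (m * suc T + ∑-block b * T + ∑[ i < m ] ρ i) + n
      ≡⟨ regroup (suc ρ̄) (m * suc T + ∑-block b * T) (∑[ i < m ] ρ i) n ⟩
    m * suc T + ∑-block b * T + (∑[ i < m ] ρ i + n) + suc ρ̄
      ≡⟨ cong (λ x → m * suc T + ∑-block b * T + x + suc ρ̄) alternating ⟩
    m * suc T + ∑-block b * T + (n * T + reflect h ℓ) + suc ρ̄
      ≡⟨ regroup′ (m * suc T + ∑-block b * T) (n * T) (reflect h ℓ) ρ̄ ⟩
    m * suc T + ∑-block b * T + n * T + suc (reflect h ℓ + ρ̄)
      ≡⟨ cong (m * suc T + ∑-block b * T + n * T +_) (reflect-pair h (slot-<T j<r t<2s)) ⟩
    m * suc T + ∑-block b * T + n * T + T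
      ≡⟨ move-last (m * suc T) (∑-block b * T) (n * T) T ⟩
    T + m * suc T + ∑-block b * T + n * T
      ∎
    where
    h = odd t
    ℓ = slot j t
    ρ̄ = reflect (not h) ℓ
    ρ = λ i → reflect (h xor odd i) ℓ
    ∑-blocks : ∑[ i < m ] (suc T + block b i * T) ≡ m * suc T + ∑-block b * T
    ∑-blocks = trans (∑-distrib-+ m (λ _ → suc T) (λ i → block b i * T))
                     (cong₂ _+_ (∑-const m (suc T)) (∑-*ʳ m (block b) T))
    alternating : ∑[ i < m ] ρ i + n ≡ n * T + reflect h ℓ
    alternating = trans (cong (λ l → ∑[ i < l ] ρ i + n) m≡1+2n)
                        (∑-reflect-alternating h n (slot-<T j<r t<2s))
    regroup : ∀ a x y n → a + (x + y) + n ≡ x + (y + n) + a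
    regroup = solve-∀
    regroup′ : ∀ x y z a → x + (y + z) + suc a ≡ x + y + suc (z + a)
    regroup′ = solve-∀
    move-last : ∀ a b c d → a + b + c + d ≡ d + a + b + c
    move-last = solve-∀

  -- The three vertex sums, written as T (n+1) k + y for comparing them.
  A B C : ℕ
  A = T * suc n * (2 * suc n) + suc n
  B = T * suc n * (6 * n + 2) + (T + suc n)
  C = T * suc n * (8 * s) + 2 * s

  sumK≡A : ∀ {j t} → j < r → t < 2 * s → sumK j t false ≡ A
  sumK≡A j<r t<2s = +-cancelʳ-≡ n _ _ (trans (sumK-+n false j<r t<2s)
    (trans (cong (λ X → T + m * suc T + X * T + n * T) ∑-block-false) (sym (closed-form n T))))
    where
    closed-form : ∀ n T → T * suc n * (2 * suc n) + suc n + n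
                        ≡ T + (2 * n + 1) * suc T + n * (2 * n + 1) * T + n * T
    closed-form = solve-∀

  sumK≡B : ∀ {j t} → j < r → t < 2 * s → sumK j t true ≡ B
  sumK≡B j<r t<2s = +-cancelʳ-≡ n _ _ (trans (sumK-+n true j<r t<2s)
    (trans (cong (λ X → T + m * suc T + X * T + n * T) ∑-block-true) (sym (closed-form n T))))
    where
    closed-form : ∀ n T → T * suc n * (6 * n + 2) + (T + suc n) + n
                        ≡ T + (2 * n + 1) * suc T + ((2 * n + 1) * (2 * n + 1) + n * (2 * n + 1)) * T + n * T
    closed-form = solve-∀

  sumO : ℕ → ℕ → ℕ
  sumO j i = ∑[ p < 2 * (2 * s) ] suc (crossLabel j ⌊ p /2⌋ (odd p) i)

  crossLabel-2* : ∀ j a b i → crossLabel j (2 * a) b i ≡ T + block b i * T + reflect (odd i) (j * s + a)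
  crossLabel-2* j a b i =
    cong₂ (λ o c → T + block b i * T + reflect (o xor odd i) (j * s + c)) (odd-2* a) (⌊2*n/2⌋≡n a)

  crossLabel-1+2* : ∀ j a b i → crossLabel j (suc (2 * a)) b i ≡ T + block b i * T + reflect (not (odd i)) (j * s + a)
  crossLabel-1+2* j a b i =
    cong₂ (λ o c → T + block b i * T + reflect (o xor odd i) (j * s + c)) (odd-1+2* a) (⌊1+2*n/2⌋≡n a)

  -- The contribution to O-vertex i of the four cross edges from the matching edges 2a and 2a+1;
  -- matching the hypotheses with refl turns it into a ring identity.
  quadruple : ∀ {T m} i d ρ ρ′ → suc (ρ + ρ′) ≡ T → suc (i + d) ≡ m →
    suc (T + i * T + ρ) + suc (T + (m + d) * T + ρ) + (suc (T + i * T + ρ′) + suc (T + (m + d) * T + ρ′))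
      ≡ 2 + (4 * m + 4) * T
  quadruple i d ρ ρ′ refl refl = solve i d ρ ρ′
    where
    solve : ∀ i d ρ ρ′ → let T = suc (ρ + ρ′); m = suc (i + d) in
      suc (T + i * T + ρ) + suc (T + (m + d) * T + ρ) + (suc (T + i * T + ρ′) + suc (T + (m + d) * T + ρ′))
        ≡ 2 + (4 * m + 4) * T
    solve = solve-∀

  sumO≡C : ∀ {j i} → j < r → i < m → sumO j i ≡ C
  sumO≡C {j} {i} j<r i<m = begin
    ∑[ p < 2 * (2 * s) ] g p                       ≡⟨ ∑-pairs (2 * s) g ⟩
    ∑[ t < 2 * s ] (g (2 * t) + g (suc (2 * t)))   ≡⟨ ∑-cong (2 * s) g-pair ⟩
    ∑[ t < 2 * s ] F t                             ≡⟨ ∑-pairs s F ⟩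
    ∑[ a < s ] (F (2 * a) + F (suc (2 * a)))       ≡⟨ ∑-cong< s F-pair ⟩
    ∑[ a < s ] (2 + (4 * m + 4) * T)               ≡⟨ ∑-const s _ ⟩
    s * (2 + (4 * m + 4) * T)                      ≡⟨ closed-form n s T ⟩
    C                                              ∎
    where
    g = λ p → suc (crossLabel j ⌊ p /2⌋ (odd p) i)
    F = λ t → suc (crossLabel j t false i) + suc (crossLabel j t true i)
    g-pair : ∀ t → g (2 * t) + g (suc (2 * t)) ≡ F t
    g-pair t = cong₂ _+_ (cong₂ (λ t′ b → suc (crossLabel j t′ b i)) (⌊2*n/2⌋≡n t) (odd-2* t))
                         (cong₂ (λ t′ b → suc (crossLabel j t′ b i)) (⌊1+2*n/2⌋≡n t) (odd-1+2* t))
    F-pair : ∀ a → a < s → F (2 * a) + F (suc (2 * a)) ≡ 2 + (4 * m + 4) * T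
    F-pair a a<s = begin
      F (2 * a) + F (suc (2 * a))
        ≡⟨ cong₂ _+_ (cong₂ (λ x y → suc x + suc y) (crossLabel-2* j a false i) (crossLabel-2* j a true i))
                     (cong₂ (λ x y → suc x + suc y) (crossLabel-1+2* j a false i) (crossLabel-1+2* j a true i)) ⟩
      _ ≡⟨ quadruple i (m ∸ suc i) _ _ (reflect-pair (odd i) (position-<T j<r a<s)) (m+[n∸m]≡n i<m) ⟩
      2 + (4 * m + 4) * T ∎
    closed-form : ∀ n s T → s * (2 + (4 * (2 * n + 1) + 4) * T) ≡ T * suc n * (8 * s) + 2 * s
    closed-form = solve-∀

  1<2s : 1 < 2 * s
  1<2s = *-monoʳ-≤ 2 (s≤s z≤n)

  2s≤T : 2 * s ≤ T
  2s≤T = subst (_≤ T) (cong (s +_) (sym (+-identityʳ s))) (+-mono-≤ (m≤n*m s r) (m≤n*m s r))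

  A<B : A < B
  A<B = +-mono-≤-< (*-monoʳ-≤ (T * suc n) 2[1+n]≤6n+2) (m<n+m (suc n) z<s)
    where
    6n+2≡2[1+n]+4n : ∀ n → 6 * n + 2 ≡ 2 * suc n + 4 * n
    6n+2≡2[1+n]+4n = solve-∀
    2[1+n]≤6n+2 : 2 * suc n ≤ 6 * n + 2
    2[1+n]≤6n+2 = subst (2 * suc n ≤_) (sym (6n+2≡2[1+n]+4n n)) (m≤m+n (2 * suc n) (4 * n))

  A≢C : A ≢ C
  A≢C with 4 * s ≤? suc n
  ... | yes 4s≤1+n = >⇒≢ (+-mono-≤-< (*-monoʳ-≤ (T * suc n) 8s≤2[1+n]) 2s<1+n)
    where
    8s≤2[1+n] : 8 * s ≤ 2 * suc n
    8s≤2[1+n] = subst (_≤ 2 * suc n) (sym (*-assoc 2 4 s)) (*-monoʳ-≤ 2 4s≤1+n)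
    2s<1+n : 2 * s < suc n
    2s<1+n = <-≤-trans (*-monoˡ-< s {2} {4} (s≤s (s≤s (s≤s z≤n)))) 4s≤1+n
  ... | no 4s≰1+n = <⇒≢ (P*k+y<P*l+c (T * suc n) 2[1+n]<8s (m≤n⇒m≤1+n (m≤n*m (suc n) T)) 1<2s)
    where
    2[1+n]<8s : 2 * suc n < 8 * s
    2[1+n]<8s = subst (2 * suc n <_) (sym (*-assoc 2 4 s)) (*-monoʳ-< 2 (≰⇒> 4s≰1+n))

  B≢C : B ≢ C
  B≢C with 8 * s ≤? 6 * n + 2
  ... | yes 8s≤6n+2 = >⇒≢ (+-mono-≤-< (*-monoʳ-≤ (T * suc n) 8s≤6n+2) (≤-<-trans 2s≤T (m<m+n T z<s)))
  ... | no 8s≰6n+2 = <⇒≢ (P*k+y<P*l+c (T * suc n) (≰⇒> 8s≰6n+2) T+1+n≤1+T[1+n] 1<2s)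
    where
    T+1+n≤1+T[1+n] : T + suc n ≤ suc (T * suc n)
    T+1+n≤1+T[1+n] = subst₂ _≤_ (sym (+-suc T n)) (cong suc (sym (*-suc T n))) (s≤s (+-monoʳ-≤ T (m≤n*m n T)))

  q : ℕ
  q = T + (m + m) * T

  matchingLabel-< : ∀ {j t} → j < r → t < 2 * s → matchingLabel j t < T
  matchingLabel-< {t = t} j<r t<2s = reflect-< (not (odd t)) (slot-<T j<r t<2s)

  T≤crossLabel : ∀ j t b i → T ≤ crossLabel j t b i
  T≤crossLabel j t b i = ≤-trans (m≤m+n T (block b i * T)) (m≤m+n _ _)

  crossLabel-< : ∀ {j t} b {i} → j < r → t < 2 * s → i < m → crossLabel j t b i < q
  crossLabel-< {j} {t} b {i} j<r t<2s i<m = <-≤-trans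
    (+-monoʳ-< (T + block b i * T) (reflect-< (odd t xor odd i) (slot-<T j<r t<2s)))
    (subst (_≤ q) (sym (+-assoc T (block b i * T) T))
      (+-monoʳ-≤ T (subst (_≤ (m + m) * T) (+-comm T (block b i * T)) (*-monoˡ-≤ T (block-< b i<m)))))

  slot-odd-injective : ∀ {j j′ t t′} → t < 2 * s → t′ < 2 * s →
    slot j t ≡ slot j′ t′ → odd t ≡ odd t′ → j ≡ j′ × t ≡ t′
  slot-odd-injective {t = t} {t′} t<2s t′<2s slot≡ odd≡ with slot-injective t<2s t′<2s slot≡
  ... | j≡j′ , ⌊t/2⌋≡ = j≡j′ , ⌊n/2⌋-odd-injective t t′ ⌊t/2⌋≡ odd≡

  matchingLabel-injective : ∀ {j j′ t t′} → j < r → j′ < r → t < 2 * s → t′ < 2 * s →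
    matchingLabel j t ≡ matchingLabel j′ t′ → j ≡ j′ × t ≡ t′
  matchingLabel-injective {t = t} {t′} j<r j′<r t<2s t′<2s eq
    with reflect-injective (not (odd t)) (not (odd t′)) (slot-< j<r t<2s) (slot-< j′<r t′<2s) eq
  ... | odd≡ , slot≡ = slot-odd-injective t<2s t′<2s slot≡ (not-injective odd≡)

  crossLabel-injective : ∀ {j j′ t t′} b b′ {i i′} → j < r → j′ < r → t < 2 * s → t′ < 2 * s → i < m → i′ < m →
    crossLabel j t b i ≡ crossLabel j′ t′ b′ i′ → j ≡ j′ × t ≡ t′ × b ≡ b′ × i ≡ i′
  crossLabel-injective {j} {j′} {t} {t′} b b′ {i} {i′} j<r j′<r t<2s t′<2s i<m i′<m eq
    with divMod-unique T (reflect-< (odd t xor odd i) (slot-<T j<r t<2s))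
                         (reflect-< (odd t′ xor odd i′) (slot-<T j′<r t′<2s))
                         (+-cancelˡ-≡ T _ _ (trans (sym (+-assoc T _ _)) (trans eq (+-assoc T _ _))))
  ... | block≡ , reflect≡ with block-injective b b′ i<m i′<m block≡
  ... | refl , refl with reflect-injective _ _ (slot-< j<r t<2s) (slot-< j′<r t′<2s) reflect≡
  ... | xor≡ , slot≡ with slot-odd-injective t<2s t′<2s slot≡ (xor-cancelʳ (odd t) (odd t′) (odd i) xor≡)
  ... | j≡j′ , t≡t′ = j≡j′ , t≡t′ , refl , refl

  K : Graph
  K = copies (2 * s) P2

  H : Graph
  H = K ∨G O m

  crossWeight : ℕ → Fin (V K) → Fin m → ℕ
  crossWeight j P i = crossLabel j ⌊ toℕ P /2⌋ (odd (toℕ P)) (toℕ i)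

  weight : ℕ → Fin (E H) → ℕ
  weight j = joinWeight K (O m) (matchingLabel j ∘ toℕ) (crossWeight j)

  weight-inner : ∀ j e → weight j (∨-inner K (O m) e) ≡ matchingLabel j (toℕ e)
  weight-inner j = joinWeight-inner K (O m) (matchingLabel j ∘ toℕ) (crossWeight j)

  weight-cross : ∀ j P i → weight j (∨-cross K (O m) P i) ≡ crossWeight j P i
  weight-cross j = joinWeight-cross K (O m) (matchingLabel j ∘ toℕ) (crossWeight j)

  ends-matching-edge : ∀ e → ends H (∨-inner K (O m) (e ↑ˡ 0)) ≡ (proj₁ (ends K e) ↑ˡ m , proj₂ (ends K e) ↑ˡ m)
  ends-matching-edge e = trans (ends-∨-inner K (O m) (e ↑ˡ 0)) (ends-⊕ˡ K (O m) e)

  edge-< : ∀ (e : Fin (E K + 0)) → toℕ e < 2 * s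
  edge-< e = subst (toℕ e <_) (trans (+-identityʳ (E K)) (E-matching (2 * s))) (toℕ<n e)

  vertex-< : ∀ (P : Fin (V K)) → ⌊ toℕ P /2⌋ < 2 * s
  vertex-< P = ⌊n/2⌋<m (toℕ P) (2 * s) (subst (toℕ P <_) (V-matching (2 * s)) (toℕ<n P))

  sideSum : Bool → ℕ
  sideSum false = A
  sideSum true  = B

  sumK≡sideSum : ∀ {j t} b → j < r → t < 2 * s → sumK j t b ≡ sideSum b
  sumK≡sideSum false = sumK≡A
  sumK≡sideSum true  = sumK≡B

  sideSum≢C : ∀ b → sideSum b ≢ C
  sideSum≢C false = A≢C
  sideSum≢C true  = B≢C

  weightSum-K : ∀ {j} → j < r → ∀ P → weightSum H (suc ∘ weight j) (P ↑ˡ m) ≡ sideSum (odd (toℕ P))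
  weightSum-K {j} j<r P = begin
    weightSum H (suc ∘ weight j) (P ↑ˡ m)
      ≡⟨ weightSum-∨ˡ K (O m) (suc ∘ weight j) P ⟩
    weightSum K (suc ∘ weight j ∘ ∨-inner K (O m) ∘ (_↑ˡ 0)) P
      + sum (tabulate (suc ∘ weight j ∘ ∨-cross K (O m) P))
      ≡⟨ cong₂ _+_ (weightSum-cong K on-matching P) (sum-tabulate-cong on-cross) ⟩
    weightSum K (suc ∘ matchingLabel j ∘ toℕ) P + sum (tabulate {n = m} (g ∘ toℕ))
      ≡⟨ cong₂ _+_ (weightSum-matching (2 * s) (suc ∘ matchingLabel j) P) (sum-tabulate-toℕ m g) ⟩
    sumK j ⌊ toℕ P /2⌋ (odd (toℕ P))
      ≡⟨ sumK≡sideSum (odd (toℕ P)) j<r (vertex-< P) ⟩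
    sideSum (odd (toℕ P))
      ∎
    where
    g = λ i → suc (crossLabel j ⌊ toℕ P /2⌋ (odd (toℕ P)) i)
    on-matching : ∀ e → suc (weight j (∨-inner K (O m) (e ↑ˡ 0))) ≡ suc (matchingLabel j (toℕ e))
    on-matching e = cong suc (trans (weight-inner j (e ↑ˡ 0)) (cong (matchingLabel j) (toℕ-↑ˡ e 0)))
    on-cross : ∀ i → suc (weight j (∨-cross K (O m) P i)) ≡ g (toℕ i)
    on-cross i = cong suc (weight-cross j P i)

  weightSum-O : ∀ {j} → j < r → ∀ i → weightSum H (suc ∘ weight j) (V K ↑ʳ i) ≡ C
  weightSum-O {j} j<r i = begin
    weightSum H (suc ∘ weight j) (V K ↑ʳ i)
      ≡⟨ weightSum-∨ʳ K (O m) (suc ∘ weight j) i ⟩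
    sum (tabulate λ P → suc (weight j (∨-cross K (O m) P i)))
      ≡⟨ sum-tabulate-cong (λ P → cong suc (weight-cross j P i)) ⟩
    sum (tabulate {n = V K} (g ∘ toℕ))
      ≡⟨ sum-tabulate-toℕ (V K) g ⟩
    ∑[ p < V K ] g p
      ≡⟨ cong (λ l → ∑[ p < l ] g p) (V-matching (2 * s)) ⟩
    sumO j (toℕ i)
      ≡⟨ sumO≡C j<r (toℕ<n i) ⟩
    C
      ∎
    where
    g = λ p → suc (crossLabel j ⌊ p /2⌋ (odd p) (toℕ i))

  ABC : List ℕ
  ABC = A ∷ B ∷ C ∷ []

  sideSum-∈ : ∀ b → sideSum b ∈ ABC
  sideSum-∈ false = here refl
  sideSum-∈ true  = there (here refl)

  colours-H : ∀ {j} → j < r → ∀ v → weightSum H (suc ∘ weight j) v ∈ ABC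
  colours-H j<r v with split (V K) m v
  ... | left P  = subst (_∈ ABC) (sym (weightSum-K j<r P)) (sideSum-∈ (odd (toℕ P)))
  ... | right i = subst (_∈ ABC) (sym (weightSum-O j<r i)) (there (there (here refl)))

  proper-H : ∀ {j} → j < r → Proper H (suc ∘ weight j)
  proper-H {j} j<r e with joinEdge K (O m) e
  ... | cross P i = proper-at H (suc ∘ weight j) (∨-cross K (O m) P i) (ends-∨-cross K (O m) P i) λ eq →
    sideSum≢C (odd (toℕ P)) (trans (sym (weightSum-K j<r P)) (trans eq (weightSum-O j<r i)))
  ... | inner e′ with split (E K) 0 e′
  ...   | right ()
  ...   | left e = proper-at H (suc ∘ weight j) (∨-inner K (O m) (e ↑ˡ 0)) (ends-matching-edge e) λ eq →
    <⇒≢ A<B (trans (sym (sideSum-end proj₁ odd-first)) (trans eq (sideSum-end proj₂ odd-second)))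
    where
    sideSum-end : ∀ end {b} → odd (toℕ (end (ends K e))) ≡ b →
                  weightSum H (suc ∘ weight j) (end (ends K e) ↑ˡ m) ≡ sideSum b
    sideSum-end end odd≡b = trans (weightSum-K j<r (end (ends K e))) (cong sideSum odd≡b)
    odd-first : odd (toℕ (proj₁ (ends K e))) ≡ false
    odd-first = trans (cong odd (proj₁ (ends-matching (2 * s) e))) (odd-2* (toℕ e))
    odd-second : odd (toℕ (proj₂ (ends K e))) ≡ true
    odd-second = trans (cong odd (proj₂ (ends-matching (2 * s) e))) (odd-1+2* (toℕ e))

  weight-< : ∀ {j} → j < r → ∀ e → weight j e < q
  weight-< {j} j<r e with joinEdge K (O m) e
  ... | inner e′  = subst (_< q) (sym (weight-inner j e′))
                          (<-≤-trans (matchingLabel-< j<r (edge-< e′)) (m≤m+n T ((m + m) * T)))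
  ... | cross P i = subst (_< q) (sym (weight-cross j P i))
                          (crossLabel-< (odd (toℕ P)) j<r (vertex-< P) (toℕ<n i))

  weight-injective : ∀ {j j′ e e′} → j < r → j′ < r → weight j e ≡ weight j′ e′ → j ≡ j′ × e ≡ e′
  weight-injective {j} {j′} {e} {e′} j<r j′<r eq with joinEdge K (O m) e | joinEdge K (O m) e′
  ... | inner d | inner d′
    with j≡j′ , toℕ≡ ← matchingLabel-injective j<r j′<r (edge-< d) (edge-< d′)
                         (trans (sym (weight-inner j d)) (trans eq (weight-inner j′ d′))) =
    j≡j′ , cong (∨-inner K (O m)) (toℕ-injective toℕ≡)
  ... | cross P i | cross P′ i′
    with j≡j′ , ⌊⌋≡ , odd≡ , toℕ≡ ← crossLabel-injective (odd (toℕ P)) (odd (toℕ P′)) j<r j′<r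
                         (vertex-< P) (vertex-< P′) (toℕ<n i) (toℕ<n i′)
                         (trans (sym (weight-cross j P i)) (trans eq (weight-cross j′ P′ i′))) =
    j≡j′ , cong₂ (∨-cross K (O m)) (toℕ-injective (⌊n/2⌋-odd-injective (toℕ P) (toℕ P′) ⌊⌋≡ odd≡))
                                   (toℕ-injective toℕ≡)
  ... | inner d | cross P′ i′ = contradiction
    (trans (sym (weight-inner j d)) (trans eq (weight-cross j′ P′ i′)))
    (<⇒≢ (<-≤-trans (matchingLabel-< j<r (edge-< d)) (T≤crossLabel j′ ⌊ toℕ P′ /2⌋ (odd (toℕ P′)) (toℕ i′))))
  ... | cross P i | inner d′ = contradiction
    (trans (sym (weight-inner j′ d′)) (trans (sym eq) (weight-cross j P i)))
    (<⇒≢ (<-≤-trans (matchingLabel-< j′<r (edge-< d′)) (T≤crossLabel j ⌊ toℕ P /2⌋ (odd (toℕ P)) (toℕ i))))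

  Γ : Graph
  Γ = copies r H

  E-Γ : E Γ ≡ q
  E-Γ = begin
    E (copies r H)                                   ≡⟨ E-copies H r ⟩
    r * ((E K + 0) + V K * m)
      ≡⟨ cong₂ (λ a b → r * ((a + 0) + b * m)) (E-matching (2 * s)) (V-matching (2 * s)) ⟩
    r * ((2 * s + 0) + 2 * (2 * s) * m)              ≡⟨ closed-form r s n ⟩
    q                                                ∎
    where
    closed-form : ∀ r s n → r * ((2 * s + 0) + 2 * (2 * s) * (2 * n + 1))
                          ≡ r * s + r * s + ((2 * n + 1) + (2 * n + 1)) * (r * s + r * s)
    closed-form = solve-∀

  labels : Fin (E Γ) → ℕ
  labels = copiesWeight H weight r

  labels-< : ∀ e → labels e < E Γ
  labels-< e = subst (labels e <_) (sym E-Γ) (copiesWeight-< H weight r (λ j j<r → weight-< j<r) e)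

  labels-injective : Injective _≡_ _≡_ labels
  labels-injective = copiesWeight-injective H weight r weight-injective

  labeling : Labeling Γ
  labeling = labelingFrom labels labels-< labels-injective

  label≡ : ∀ e → label Γ labeling e ≡ copiesWeight H (λ j → suc ∘ weight j) r e
  label≡ e = trans (label-labelingFrom Γ labels labels-< labels-injective e)
                   (sym (copiesWeight-map H suc weight r e))

  vsum≡ : ∀ v → vsum Γ labeling v ≡ weightSum Γ (copiesWeight H (λ j → suc ∘ weight j) r) v
  vsum≡ = weightSum-cong Γ label≡

  antimagic : IsLocalAntimagic Γ labeling
  antimagic = proper-cong Γ (sym ∘ label≡) (proper-copies H (λ j → suc ∘ weight j) r λ j j<r → proper-H j<r)

  colours-Γ : ∀ v → vsum Γ labeling v ∈ ABC
  colours-Γ v with j , j<r , v₀ , eq ← weightSum-copies H (λ j → suc ∘ weight j) r v =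
    subst (_∈ ABC) (sym (trans (vsum≡ v) eq)) (colours-H j<r v₀)

  first : Fin (V H) → Fin (V Γ)
  first v = v ↑ˡ V (copies r′ H)

  vsum-first : ∀ v → vsum Γ labeling (first v) ≡ weightSum H (suc ∘ weight 0) v
  vsum-first v = trans (vsum≡ (first v)) (weightSum-first-copy H (λ j → suc ∘ weight j) r′ v)

  ends-first : ∀ e {a b} → ends H e ≡ (a , b) → ends Γ (e ↑ˡ E (copies r′ H)) ≡ (first a , first b)
  ends-first e eq = trans (ends-⊕ˡ H (copies r′ H) e) (cong (λ ab → first (proj₁ ab) , first (proj₂ ab)) eq)

  i₀ : Fin m
  i₀ = fromℕ< (m≤n+m 1 (2 * n))

  P₀ P₁ : Fin (V K)
  P₀ = zero
  P₁ = suc zero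

  attained : ∀ {x} → x ∈ ABC → ∃[ v ] vsum Γ labeling v ≡ x
  attained (here refl)                 = first (P₀ ↑ˡ m) , trans (vsum-first (P₀ ↑ˡ m)) (weightSum-K z<s P₀)
  attained (there (here refl))         = first (P₁ ↑ˡ m) , trans (vsum-first (P₁ ↑ˡ m)) (weightSum-K z<s P₁)
  attained (there (there (here refl))) = first (V K ↑ʳ i₀) , trans (vsum-first (V K ↑ʳ i₀)) (weightSum-O z<s i₀)

  χla≡3 : χla≡ Γ 3
  χla≡3 = (labeling , antimagic , numColors≡3) , λ g antimagic-g →
    triangle⇒3≤numColors Γ g antimagic-g
      (∨-inner K (O m) (zero ↑ˡ 0) ↑ˡ E (copies r′ H))
      (∨-cross K (O m) P₀ i₀ ↑ˡ E (copies r′ H))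
      (∨-cross K (O m) P₁ i₀ ↑ˡ E (copies r′ H))
      (ends-first (∨-inner K (O m) (zero ↑ˡ 0)) (ends-matching-edge zero))
      (ends-first (∨-cross K (O m) P₀ i₀) (ends-∨-cross K (O m) P₀ i₀))
      (ends-first (∨-cross K (O m) P₁ i₀) (ends-∨-cross K (O m) P₁ i₀))
    where
    numColors≡3 : numColors Γ labeling ≡ 3
    numColors≡3 = ≤-antisym (numColors-≤ Γ labeling ABC colours-Γ)
      (numColors-≥ Γ labeling ABC ((<⇒≢ A<B ∷ A≢C ∷ []) ∷ (B≢C ∷ []) ∷ [] ∷ []) attained)

theorem3p3 : (n r s : ℕ) → 1 ≤ n → 2 ≤ r → 1 ≤ s →
    χla≡ (copies r (copies (2 * s) P2 ∨G O (2 * n + 1))) 3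
theorem3p3 n (suc (suc r)) (suc s′) _ _ _ = Construction.χla≡3 n s′ (suc r)
theorem3p3 n (suc zero)    s        _ (s≤s ()) _
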